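{- Let $p$ be a prime and let $(R,M)$ be a finite commutative local ring whose residue field $k=R/M$ has characteristic $p$, with $-1\in (R^{\times})^p$. Then ${\rm Cay}(R,(R^{\times})^p)$ is connected if and only if $M=pR$. Furthermore, when $p=2$: ${\rm Cay}(R,(R^{\times})^2)$ is connected if and only if $M=2R=0$, if and only if $R$ is a field, if and only if $G_R(2)\cong K_{|R|}$.
   Context: $(R^{\times})^p=\{u^p:u\in R^{\times}\}$; the paper assumes throughout $-1\in (R^{\times})^p$. ${\rm Cay}(R,(R^{\times})^p)=G_R(p)$ is the simple undirected graph with vertex set $R$ in which $a,b$ are adjacent iff $a-b\in (R^{\times})^p$. $K_n$ is the complete graph on $n$ vertices. -}

module Defs where

open import Level using (0ℓ)
open import Algebra.Bundles using (CommutativeRing; Semiring)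
open import Data.Nat using (ℕ; zero; suc; _<_)
open import Data.Fin using (Fin)
open import Data.Product using (Σ; ∃; _×_; _,_)
open import Data.Sum using (_⊎_)
open import Relation.Nullary using (¬_)
open import Relation.Unary using (Pred; _⊆_)
open import Relation.Binary.PropositionalEquality as ≡ using (_≡_)
open import Relation.Binary.Construct.Closure.ReflexiveTransitive using (Star)
open import Function.Bundles using (Bijection; _⇔_)

module _ (R : CommutativeRing 0ℓ 0ℓ) where
  open CommutativeRing R
  open import Algebra.Definitions.RawSemiring (Semiring.rawSemiring semiring) using (_^_) renaming (_×_ to _·_)

  _≐_ : Pred Carrier 0ℓ → Pred Carrier 0ℓ → Set
  A ≐ B = (A ⊆ B) × (B ⊆ A)

  IsUnit : Carrier → Set
  IsUnit u = ∃ λ v → u * v ≈ 1#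

  UnitPow : ℕ → Pred Carrier 0ℓ
  UnitPow p x = ∃ λ u → IsUnit u × (x ≈ u ^ p)

  record IsIdeal (I : Pred Carrier 0ℓ) : Set where
    field
      resp  : ∀ {x y} → x ≈ y → I x → I y
      zero∈ : I 0#
      +-cl  : ∀ {x y} → I x → I y → I (x + y)
      *-cl  : ∀ r {x} → I x → I (r * x)

  record IsMaximalIdeal (I : Pred Carrier 0ℓ) : Set₁ where
    field
      ideal  : IsIdeal I
      proper : ¬ I 1#
      maximal : ∀ (J : Pred Carrier 0ℓ) → IsIdeal J → I ⊆ J → (J ≐ I) ⊎ J 1#

  record IsLocal (M : Pred Carrier 0ℓ) : Set₁ where
    field
      maxM   : IsMaximalIdeal M
      unique : ∀ (J : Pred Carrier 0ℓ) → IsMaximalIdeal J → J ≐ M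

  Card : ℕ → Set
  Card n = Bijection setoid (≡.setoid (Fin n))

  -- the residue field R/M has characteristic p:
  -- p is the least positive n with n·1 = 0 in R/M, i.e. n·1 ∈ M
  ResidueChar : Pred Carrier 0ℓ → ℕ → Set
  ResidueChar M p = (0 < p) × M (p · 1#) × (∀ n → 0 < n → n < p → ¬ M (n · 1#))

  multiplesOf : ℕ → Pred Carrier 0ℓ
  multiplesOf p x = ∃ λ r → x ≈ (p · 1#) * r

  zeroIdeal : Pred Carrier 0ℓ
  zeroIdeal x = x ≈ 0#

  IsField : Set
  IsField = (¬ 1# ≈ 0#) × (∀ x → ¬ x ≈ 0# → IsUnit x)

  -- adjacency in Cay(R, (R^×)^p) = G_R(p)
  Adj : ℕ → Carrier → Carrier → Set
  Adj p a b = UnitPow p (a - b)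

  -- connectivity of Cay(R,(R^×)^p); vertices are R up to ≈, so ≈-steps are
  -- identity steps
  Connected : ℕ → Set
  Connected p = ∀ a b → Star (λ x y → (x ≈ y) ⊎ Adj p x y) a b

  -- graph isomorphism G_R(p) ≅ K_n, where K_n has vertex set Fin n and
  -- i, j adjacent iff i ≢ j
  IsoComplete : ℕ → ℕ → Set
  IsoComplete p n = Σ (Card n) λ f →
    ∀ a b → Adj p a b ⇔ (¬ Bijection.to f a ≡ Bijection.to f b)

{-# OPTIONS --safe #-}
module Submission where

-- Write q = p·1, which lies in M. Modulo pR the Frobenius map x ↦ x^p is additive (p divides
-- the inner binomial coefficients), and modulo M it is injective (M is prime) and therefore, R
-- being finite, bijective. Elements of M are nilpotent.
--
-- If M = pR, every r is s + q r' with s = 0 or s a p-th power of a unit, hence r = s₀ + q s₁ + …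
-- + q^N s_N with q^N = 0, a sum of generators of the Cayley graph; as -1 is a p-th power, steps
-- may be taken in both directions. Conversely, the difference of the ends of a walk is a sum of
-- p-th powers, hence a p-th power modulo pR; so if the graph is connected, each m ∈ M is
-- congruent modulo pR to y^(p^k) with y ∈ M for every k, and y^(p^|R|) = 0.

open import Defs
open import Level using (0ℓ)
open import Algebra.Bundles using (CommutativeRing; Semiring)
open import Data.Nat.Base as ℕ using (ℕ; zero; suc; _<_; _≤_; z≤n; s≤s; NonZero; _!)
import Data.Nat.Properties as ℕ
open import Data.Nat.Divisibility using (_∣_; _∤_; divides; ∣1⇒≡1; ∣⇒≤; m∣m*n)
open import Data.Nat.DivMod using (m/n*n≡m)
open import Data.Nat.Combinatorics using (_C_; nCk≡n!/k![n-k]!; k![n∸k]!∣n!; nCn≡1)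
open import Data.Nat.Primality using (Prime; euclidsLemma; ¬prime[0]; ¬prime[1]; prime⇒nonZero; prime⇒nonTrivial; prime[2])
open import Data.Integer.Base as ℤ using (ℤ; +_; -[1+_]; _⊖_; ∣_∣; sign; _◃_)
import Data.Integer.Properties as ℤ
open import Data.Sign.Base as Sign using (Sign)
open import Data.Fin.Base as Fin using (Fin)
import Data.Fin.Properties as Fin
open import Data.Maybe.Base using (Maybe; just; nothing)
open import Data.Product.Base using (Σ; ∃; ∃₂; _×_; _,_; proj₁; proj₂)
open import Data.Sum.Base using (_⊎_; inj₁; inj₂; [_,_]′)
open import Function.Base using (id; _∘_)
open import Function.Bundles using (_⇔_; mk⇔; Equivalence; Bijection; Inverse)
open import Function.Properties.Bijection using (Bijection⇒Inverse)
open import Relation.Nullary using (¬_; Dec; yes; no; contradiction)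
open import Relation.Unary using (Pred; _⊆_)
open import Relation.Binary.PropositionalEquality as ≡ using (_≡_)
open import Relation.Binary.Construct.Closure.ReflexiveTransitive using (Star; ε; _◅_; _◅◅_)
open import Algebra.Solver.Ring.AlmostCommutativeRing using (_-Raw-AlmostCommutative⟶_; fromCommutativeRing)

-- With coefficients in R itself, which has no decidable zero test, the ring solvers cannot
-- cancel x - x; so coefficients are taken in ℤ, mapped into R by its canonical homomorphism.
module IntegerCoefficientSolver {c ℓ} (R : CommutativeRing c ℓ) where
  open CommutativeRing R
  open import Algebra.Properties.Ring ring using (-‿involutive; -0#≈0#; -1*x≈-x; -‿+-comm)
  open import Algebra.Properties.CommutativeSemigroup +-commutativeSemigroup using () renaming (interchange to +-interchange)
  open import Algebra.Properties.CommutativeSemigroup *-commutativeSemigroup using () renaming (interchange to *-interchange)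
  open import Algebra.Properties.Semiring.Mult.TCOptimised semiring using (1+×; ×-homo-+; ×1-homo-*) renaming (_×_ to _×′_)
  open import Relation.Binary.Reasoning.Setoid setoid

  private
    ι : ℕ → Carrier
    ι k = k ×′ 1#

    fromℤ : ℤ → Carrier
    fromℤ (+ k)    = ι k
    fromℤ -[1+ k ] = - ι (suc k)

    fromSign : Sign → Carrier
    fromSign Sign.+ = 1#
    fromSign Sign.- = - 1#

    1+x-[1+y]≈x-y : ∀ x y → (1# + x) - (1# + y) ≈ x - y
    1+x-[1+y]≈x-y x y = begin
      (1# + x) - (1# + y)       ≈⟨ +-congˡ (-‿+-comm 1# y) ⟨
      (1# + x) + (- 1# + - y)   ≈⟨ +-interchange 1# x (- 1#) (- y) ⟩
      (1# - 1#) + (x - y)       ≈⟨ +-congʳ (-‿inverseʳ 1#) ⟩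
      0# + (x - y)              ≈⟨ +-identityˡ (x - y) ⟩
      x - y                     ∎

    ⊖-homo : ∀ m n → fromℤ (m ⊖ n) ≈ ι m - ι n
    ⊖-homo m       zero    = sym (trans (+-congˡ -0#≈0#) (+-identityʳ (ι m)))
    ⊖-homo zero    (suc n) = sym (+-identityˡ _)
    ⊖-homo (suc m) (suc n) = begin
      fromℤ (suc m ⊖ suc n)    ≡⟨ ≡.cong fromℤ (ℤ.[1+m]⊖[1+n]≡m⊖n m n) ⟩
      fromℤ (m ⊖ n)            ≈⟨ ⊖-homo m n ⟩
      ι m - ι n                ≈⟨ 1+x-[1+y]≈x-y (ι m) (ι n) ⟨
      (1# + ι m) - (1# + ι n)  ≈⟨ +-cong (1+× m 1#) (-‿cong (1+× n 1#)) ⟨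
      ι (suc m) - ι (suc n)    ∎

    +-homo : ∀ i j → fromℤ (i ℤ.+ j) ≈ fromℤ i + fromℤ j
    +-homo (+ m)    (+ n)    = ×-homo-+ 1# m n
    +-homo (+ m)    -[1+ n ] = ⊖-homo m (suc n)
    +-homo -[1+ m ] (+ n)    = trans (⊖-homo n (suc m)) (+-comm _ _)
    +-homo -[1+ m ] -[1+ n ] = begin
      - ι (suc (suc (m ℕ.+ n)))  ≡⟨ ≡.cong (λ k → - ι (suc k)) (ℕ.+-suc m n) ⟨
      - ι (suc m ℕ.+ suc n)      ≈⟨ -‿cong (×-homo-+ 1# (suc m) (suc n)) ⟩
      - (ι (suc m) + ι (suc n))  ≈⟨ -‿+-comm _ _ ⟨
      - ι (suc m) + - ι (suc n)  ∎

    -‿homo : ∀ i → fromℤ (ℤ.- i) ≈ - fromℤ i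
    -‿homo (+ zero)  = sym -0#≈0#
    -‿homo (+ suc n) = refl
    -‿homo -[1+ n ]  = sym (-‿involutive _)

    ◃-homo : ∀ s k → fromℤ (s ◃ k) ≈ fromSign s * ι k
    ◃-homo s       zero    = sym (zeroʳ _)
    ◃-homo Sign.+ (suc k) = sym (*-identityˡ _)
    ◃-homo Sign.- (suc k) = sym (-1*x≈-x _)

    sign-abs-homo : ∀ i → fromℤ i ≈ fromSign (sign i) * ι ∣ i ∣
    sign-abs-homo (+ k)    = sym (*-identityˡ _)
    sign-abs-homo -[1+ k ] = sym (-1*x≈-x _)

    sign-*-homo : ∀ s t → fromSign (s Sign.* t) ≈ fromSign s * fromSign t
    sign-*-homo Sign.+ t      = sym (*-identityˡ _)
    sign-*-homo Sign.- Sign.+ = sym (*-identityʳ _)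
    sign-*-homo Sign.- Sign.- = sym (trans (-1*x≈-x _) (-‿involutive 1#))

    *-homo : ∀ i j → fromℤ (i ℤ.* j) ≈ fromℤ i * fromℤ j
    *-homo i j = begin
      fromℤ (sign i Sign.* sign j ◃ ∣ i ∣ ℕ.* ∣ j ∣)
        ≈⟨ ◃-homo (sign i Sign.* sign j) (∣ i ∣ ℕ.* ∣ j ∣) ⟩
      fromSign (sign i Sign.* sign j) * ι (∣ i ∣ ℕ.* ∣ j ∣)
        ≈⟨ *-cong (sign-*-homo (sign i) (sign j)) (×1-homo-* ∣ i ∣ ∣ j ∣) ⟩
      (fromSign (sign i) * fromSign (sign j)) * (ι ∣ i ∣ * ι ∣ j ∣)
        ≈⟨ *-interchange _ _ _ _ ⟩
      (fromSign (sign i) * ι ∣ i ∣) * (fromSign (sign j) * ι ∣ j ∣)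
        ≈⟨ *-cong (sign-abs-homo i) (sign-abs-homo j) ⟨
      fromℤ i * fromℤ j
        ∎

    homomorphism : ℤ.+-*-rawRing -Raw-AlmostCommutative⟶ fromCommutativeRing R
    homomorphism = record
      { ⟦_⟧ = fromℤ ; +-homo = +-homo ; *-homo = *-homo ; -‿homo = -‿homo
      ; 0-homo = refl ; 1-homo = refl }

    ≟-coefficients : ∀ i j → Maybe (fromℤ i ≈ fromℤ j)
    ≟-coefficients i j with i ℤ.≟ j
    ... | yes ≡.refl = just refl
    ... | no _       = nothing

  open import Algebra.Solver.Ring ℤ.+-*-rawRing (fromCommutativeRing R) homomorphism ≟-coefficients public

n<m^n : ∀ {m} → 1 < m → ∀ n → n < m ℕ.^ n
n<m^n 1<m zero    = s≤s z≤n
n<m^n 1<m (suc n) = ℕ.≤-<-trans (n<m^n 1<m n) (ℕ.^-monoʳ-< _ 1<m (ℕ.n<1+n n))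

prime∤! : ∀ {p k} → Prime p → k < p → p ∤ k !
prime∤! {k = zero}  p-prime _   p∣1   = ¬prime[1] (≡.subst Prime (∣1⇒≡1 p∣1) p-prime)
prime∤! {k = suc k} p-prime k<p p∣k! with euclidsLemma (suc k) (k !) p-prime p∣k!
... | inj₁ p∣1+k = ℕ.<⇒≱ k<p (∣⇒≤ p∣1+k)
... | inj₂ p∣k!  = prime∤! p-prime (ℕ.<⇒≤ k<p) p∣k!

n∣n! : ∀ n → .{{NonZero n}} → n ∣ n !
n∣n! (suc n) = m∣m*n (n !)

C*k!*[n∸k]!≡n! : ∀ {n k} → k ≤ n → (n C k) ℕ.* (k ! ℕ.* (n ℕ.∸ k) !) ≡ n !
C*k!*[n∸k]!≡n! {n} {k} k≤n = ≡.trans (≡.cong (ℕ._* (k ! ℕ.* (n ℕ.∸ k) !)) (nCk≡n!/k![n-k]! k≤n))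
                                     (m/n*n≡m (k![n∸k]!∣n! k≤n))
  where instance _ = k ℕ.!* (n ℕ.∸ k) !≢0

prime∣C : ∀ {p k} → Prime p → 0 < k → k < p → p ∣ p C k
prime∣C {p} {k} p-prime 0<k k<p with euclidsLemma (p C k) (k ! ℕ.* (p ℕ.∸ k) !) p-prime p∣C*k!*[p∸k]!
  where
  p∣C*k!*[p∸k]! : p ∣ (p C k) ℕ.* (k ! ℕ.* (p ℕ.∸ k) !)
  p∣C*k!*[p∸k]! = ≡.subst (p ∣_) (≡.sym (C*k!*[n∸k]!≡n! (ℕ.<⇒≤ k<p))) (n∣n! p {{prime⇒nonZero p-prime}})
... | inj₁ p∣C             = p∣C
... | inj₂ p∣k!*[p∸k]!     with euclidsLemma (k !) ((p ℕ.∸ k) !) p-prime p∣k!*[p∸k]!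
...   | inj₁ p∣k!         = contradiction p∣k! (prime∤! p-prime k<p)
...   | inj₂ p∣[p∸k]!     = contradiction p∣[p∸k]! (prime∤! p-prime (ℕ.∸-monoʳ-< 0<k (ℕ.<⇒≤ k<p)))

module IdealProperties (R : CommutativeRing 0ℓ 0ℓ) where
  open CommutativeRing R
  open import Algebra.Definitions.RawSemiring (Semiring.rawSemiring semiring) using (_^_) renaming (_×_ to _·_)
  open import Algebra.Properties.Ring ring using (-1*x≈-x; ⁻¹-anti-homo‿-; x≈y⇒x∙y⁻¹≈ε)
  open import Algebra.Properties.CommutativeSemigroup *-commutativeSemigroup using (x∙yz≈y∙xz)
  open import Algebra.Properties.Monoid.Sum +-monoid using (sum)
  open IntegerCoefficientSolver R using (solve; _:=_; _:+_; _:-_; _:*_)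

  infix 4 _≈_mod_
  _≈_mod_ : Carrier → Carrier → Pred Carrier 0ℓ → Set
  x ≈ y mod I = I (x - y)

  IsProperIdeal : Pred Carrier 0ℓ → Set
  IsProperIdeal I = IsIdeal R I × ¬ I 1#

  Multiples : Carrier → Pred Carrier 0ℓ
  Multiples a x = ∃ λ r → x ≈ a * r

  Multiples-isIdeal : ∀ a → IsIdeal R (Multiples a)
  Multiples-isIdeal a = record
    { resp  = λ { x≈y (r , x≈ar) → r , trans (sym x≈y) x≈ar }
    ; zero∈ = 0# , sym (zeroʳ a)
    ; +-cl  = λ { (r , x≈ar) (s , y≈as) → r + s , trans (+-cong x≈ar y≈as) (sym (distribˡ a r s)) }
    ; *-cl  = λ { t (r , x≈ar) → t * r , trans (*-congˡ x≈ar) (x∙yz≈y∙xz t a r) }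
    }

  Multiples-least : ∀ {I a} → IsIdeal R I → I a → Multiples a ⊆ I
  Multiples-least I-ideal Ia (r , x≈ar) = resp (sym x≈ar) (resp (*-comm r _) (*-cl r Ia))
    where open IsIdeal I-ideal

  Multiples-≈0 : ∀ {a} → a ≈ 0# → _≐_ R (Multiples a) (zeroIdeal R)
  Multiples-≈0 {a} a≈0 = (λ (r , x≈ar) → trans x≈ar (trans (*-congʳ a≈0) (zeroˡ r)))
                       , (λ {x} x≈0 → 0# , trans x≈0 (sym (zeroʳ a)))

  multiplesOf-isIdeal : ∀ p → IsIdeal R (multiplesOf R p)
  multiplesOf-isIdeal p = Multiples-isIdeal (p · 1#)

  _+⟨_⟩ : Pred Carrier 0ℓ → Carrier → Pred Carrier 0ℓ
  (I +⟨ x ⟩) y = ∃₂ λ i r → I i × y ≈ i + r * x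

  ∪-const-isIdeal : ∀ {I} → IsIdeal R I → (P : Set) → IsIdeal R (λ x → I x ⊎ P)
  ∪-const-isIdeal I-ideal P = record
    { resp  = λ { x≈y (inj₁ Ix) → inj₁ (resp x≈y Ix) ; _ (inj₂ p) → inj₂ p }
    ; zero∈ = inj₁ zero∈
    ; +-cl  = λ { (inj₁ Ix) (inj₁ Iy) → inj₁ (+-cl Ix Iy) ; (inj₂ p) _ → inj₂ p ; _ (inj₂ p) → inj₂ p }
    ; *-cl  = λ { r (inj₁ Ix) → inj₁ (*-cl r Ix) ; _ (inj₂ p) → inj₂ p }
    }
    where open IsIdeal I-ideal

  module Ideal {I : Pred Carrier 0ℓ} (I-ideal : IsIdeal R I) where
    open IsIdeal I-ideal public

    -‿cl : ∀ {x} → I x → I (- x)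
    -‿cl {x} Ix = resp (-1*x≈-x x) (*-cl (- 1#) Ix)

    *-clʳ : ∀ {x} r → I x → I (x * r)
    *-clʳ {x} r Ix = resp (*-comm r x) (*-cl r Ix)

    ^-cl : ∀ {x} k .{{_ : NonZero k}} → I x → I (x ^ k)
    ^-cl {x} (suc k) Ix = *-clʳ (x ^ k) Ix

    sum-cl : ∀ {k} (f : Fin k → Carrier) → (∀ i → I (f i)) → I (sum f)
    sum-cl {zero}  f If = zero∈
    sum-cl {suc k} f If = +-cl (If Fin.zero) (sum-cl (f ∘ Fin.suc) (If ∘ Fin.suc))

    ≈⇒≈mod : ∀ {x y} → x ≈ y → x ≈ y mod I
    ≈⇒≈mod x≈y = resp (sym (x≈y⇒x∙y⁻¹≈ε x≈y)) zero∈

    mod-sym : ∀ {x y} → x ≈ y mod I → y ≈ x mod I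
    mod-sym {x} {y} x≈y = resp (⁻¹-anti-homo‿- x y) (-‿cl x≈y)

    mod-trans : ∀ {x y z} → x ≈ y mod I → y ≈ z mod I → x ≈ z mod I
    mod-trans {x} {y} {z} x≈y y≈z = resp (telescope x y z) (+-cl x≈y y≈z)
      where
      telescope : ∀ x y z → (x - y) + (y - z) ≈ x - z
      telescope = solve 3 (λ x y z → (x :- y) :+ (y :- z) := x :- z) refl

    +-cong-mod : ∀ {x y u v} → x ≈ y mod I → u ≈ v mod I → x + u ≈ y + v mod I
    +-cong-mod {x} {y} {u} {v} x≈y u≈v = resp (regroup x y u v) (+-cl x≈y u≈v)
      where
      regroup : ∀ x y u v → (x - y) + (u - v) ≈ (x + u) - (y + v)
      regroup = solve 4 (λ x y u v → (x :- y) :+ (u :- v) := (x :+ u) :- (y :+ v)) refl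

    *-cong-mod : ∀ {x y u v} → x ≈ y mod I → u ≈ v mod I → x * u ≈ y * v mod I
    *-cong-mod {x} {y} {u} {v} x≈y u≈v = resp (regroup x y u v) (+-cl (*-cl x u≈v) (*-cl v x≈y))
      where
      regroup : ∀ x y u v → x * (u - v) + v * (x - y) ≈ x * u - y * v
      regroup = solve 4 (λ x y u v → x :* (u :- v) :+ v :* (x :- y) := x :* u :- y :* v) refl

    ^-cong-mod : ∀ {x y} k → x ≈ y mod I → x ^ k ≈ y ^ k mod I
    ^-cong-mod zero    x≈y = ≈⇒≈mod refl
    ^-cong-mod (suc k) x≈y = *-cong-mod x≈y (^-cong-mod k x≈y)

    ∈-resp-mod : ∀ {x y} → x ≈ y mod I → I y → I x
    ∈-resp-mod {x} {y} x≈y Iy = resp (cancel x y) (+-cl x≈y Iy)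
      where
      cancel : ∀ x y → (x - y) + y ≈ x
      cancel = solve 2 (λ x y → (x :- y) :+ y := x) refl

    +⟨⟩-isIdeal : ∀ x → IsIdeal R (I +⟨ x ⟩)
    +⟨⟩-isIdeal x = record
      { resp  = λ { y≈z (i , r , Ii , y≈i+rx) → i , r , Ii , trans (sym y≈z) y≈i+rx }
      ; zero∈ = 0# , 0# , zero∈ , sym (trans (+-identityˡ _) (zeroˡ x))
      ; +-cl  = λ { (i , r , Ii , y≈) (j , s , Ij , z≈) →
                    i + j , r + s , +-cl Ii Ij , trans (+-cong y≈ z≈) (regroup i j r s x) }
      ; *-cl  = λ { t (i , r , Ii , y≈) → t * i , t * r , *-cl t Ii , trans (*-congˡ y≈) (distribute i r x t) }
      }
      where
      regroup : ∀ i j r s x → (i + r * x) + (j + s * x) ≈ (i + j) + (r + s) * x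
      regroup = solve 5 (λ i j r s x → (i :+ r :* x) :+ (j :+ s :* x) := (i :+ j) :+ (r :+ s) :* x) refl
      distribute : ∀ i r x t → t * (i + r * x) ≈ t * i + (t * r) * x
      distribute = solve 4 (λ i r x t → t :* (i :+ r :* x) := t :* i :+ (t :* r) :* x) refl

    ⊆+⟨⟩ : ∀ x → I ⊆ I +⟨ x ⟩
    ⊆+⟨⟩ x {y} Iy = y , 0# , Iy , sym (trans (+-congˡ (zeroˡ x)) (+-identityʳ y))

    ∈+⟨⟩ : ∀ x → (I +⟨ x ⟩) x
    ∈+⟨⟩ x = 0# , 1# , zero∈ , sym (trans (+-identityˡ _) (*-identityˡ x))

  +⟨⟩-least : ∀ {I K x} → IsIdeal R K → I ⊆ K → K x → I +⟨ x ⟩ ⊆ K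
  +⟨⟩-least K-ideal I⊆K Kx (i , r , Ii , y≈i+rx) = resp (sym y≈i+rx) (+-cl (I⊆K Ii) (*-cl r Kx))
    where open IsIdeal K-ideal

module FrobeniusProperties (R : CommutativeRing 0ℓ 0ℓ) where
  open CommutativeRing R
  open import Algebra.Definitions.RawSemiring (Semiring.rawSemiring semiring) using (_^_) renaming (_×_ to _·_)
  open import Algebra.Properties.CommutativeSemiring.Binomial commutativeSemiring
    using (binomialTerm) renaming (theorem to binomial-theorem)
  open import Algebra.Properties.Monoid.Sum +-monoid using (sum; sum-init-last)
  open import Algebra.Properties.Monoid.Mult *-monoid using () renaming (×-idem to ^-idem)
  import Algebra.Properties.Semiring.Mult semiring as Mult
  open import Algebra.Properties.Semiring.Exp semiring using (^-congˡ)
  open import Algebra.Properties.CommutativeSemiring.Exp commutativeSemiring using (^-distrib-*)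
  open import Algebra.Properties.Ring ring using (-1*x≈-x)
  open import Relation.Binary.Reasoning.Setoid setoid
  open IdealProperties R
  open IntegerCoefficientSolver R using (solve; _:=_; _:+_; _:-_; :-_; con)

  ·1*≈· : ∀ m x → (m · 1#) * x ≈ m · x
  ·1*≈· m x = trans (Mult.×-assoc-* m 1# x) (Mult.×-congʳ m (*-identityˡ x))

  ∣⇒·∈multiplesOf : ∀ {p m} → p ∣ m → ∀ x → multiplesOf R p (m · x)
  ∣⇒·∈multiplesOf {p} (divides c ≡.refl) x = c · x , (begin
    (c ℕ.* p) · x       ≡⟨ ≡.cong (_· x) (ℕ.*-comm c p) ⟩
    (p ℕ.* c) · x       ≈⟨ Mult.×-assocˡ x p c ⟨
    p · (c · x)         ≈⟨ ·1*≈· p (c · x) ⟨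
    (p · 1#) * (c · x)  ∎)

  freshman's-dream : ∀ {p} → Prime p → ∀ x y → (x + y) ^ p ≈ x ^ p + y ^ p mod multiplesOf R p
  freshman's-dream {zero}   0-prime = contradiction 0-prime ¬prime[0]
  freshman's-dream {suc p'} p-prime x y = resp (sym difference≈middle) (sum-cl middle middle∈pR)
    where
    p = suc p'
    open Ideal (multiplesOf-isIdeal p)
    T = binomialTerm x y p

    middle : Fin p' → Carrier
    middle i = T (Fin.suc (Fin.inject₁ i))

    middle∈pR : ∀ i → multiplesOf R p (middle i)
    middle∈pR i = ∣⇒·∈multiplesOf (prime∣C p-prime (s≤s z≤n) (s≤s i<p')) _
      where
      i<p' : Fin.toℕ (Fin.inject₁ i) < p'
      i<p' = ≡.subst (_< p') (≡.sym (Fin.toℕ-inject₁ i)) (Fin.toℕ<n i)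

    first≈y^p : T Fin.zero ≈ y ^ p
    first≈y^p = trans (Mult.×-homo-1 _) (*-identityˡ _)

    last≈x^p : T (Fin.fromℕ p) ≈ x ^ p
    last≈x^p = term≈x^p (Fin.toℕ (Fin.fromℕ p)) (Fin.toℕ-fromℕ p)
      where
      term≈x^p : ∀ k → k ≡ p → (p C k) · (x ^ k * y ^ (p ℕ.∸ k)) ≈ x ^ p
      term≈x^p k ≡.refl = begin
        (p C p) · (x ^ p * y ^ (p ℕ.∸ p)) ≡⟨ ≡.cong₂ (λ c e → c · (x ^ p * y ^ e)) (nCn≡1 p) (ℕ.n∸n≡0 p) ⟩
        1 · (x ^ p * 1#)                  ≈⟨ Mult.×-homo-1 _ ⟩
        x ^ p * 1#                        ≈⟨ *-identityʳ _ ⟩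
        x ^ p                             ∎

    difference≈middle : (x + y) ^ p - (x ^ p + y ^ p) ≈ sum middle
    difference≈middle = begin
      (x + y) ^ p - (x ^ p + y ^ p)
        ≈⟨ +-congʳ (binomial-theorem p x y) ⟩
      T Fin.zero + sum (T ∘ Fin.suc) - (x ^ p + y ^ p)
        ≈⟨ +-congʳ (+-cong first≈y^p (sum-init-last (T ∘ Fin.suc))) ⟩
      y ^ p + (sum middle + T (Fin.fromℕ p)) - (x ^ p + y ^ p)
        ≈⟨ +-congʳ (+-congˡ (+-congˡ last≈x^p)) ⟩
      y ^ p + (sum middle + x ^ p) - (x ^ p + y ^ p)
        ≈⟨ cancel (x ^ p) (y ^ p) (sum middle) ⟩
      sum middle
        ∎
      where
      cancel : ∀ a b s → b + (s + a) - (a + b) ≈ s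
      cancel = solve 3 (λ a b s → b :+ (s :+ a) :- (a :+ b) := s) refl

  module _ {p} (p-prime : Prime p) where
    open Ideal (multiplesOf-isIdeal p)
    private instance _ = prime⇒nonZero p-prime

    -1^p≈-1 : (- 1#) ^ p ≈ - 1# mod multiplesOf R p
    -1^p≈-1 = resp (rearrange ((- 1#) ^ p)) (mod-sym 0≈1+[-1]^p)
      where
      0≈1+[-1]^p : 0# ≈ 1# + (- 1#) ^ p mod multiplesOf R p
      0≈1+[-1]^p = mod-trans (≈⇒≈mod (sym (trans (^-congˡ p (-‿inverseʳ 1#)) (^-idem (zeroˡ 0#) p))))
                   (mod-trans (freshman's-dream p-prime 1# (- 1#)) (≈⇒≈mod (+-congʳ (^-idem (*-identityˡ 1#) p))))
      rearrange : ∀ a → (1# + a) - 0# ≈ a - - 1#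
      rearrange = solve 1 (λ a → (con (ℤ.+ 1) :+ a) :- con (ℤ.+ 0) := a :- :- con (ℤ.+ 1)) refl

    frobenius-‿ : ∀ x y → (x - y) ^ p ≈ x ^ p - y ^ p mod multiplesOf R p
    frobenius-‿ x y = mod-trans (freshman's-dream p-prime x (- y)) (+-cong-mod (≈⇒≈mod refl) [-y]^p≈-y^p)
      where
      [-y]^p≈-y^p : (- y) ^ p ≈ - (y ^ p) mod multiplesOf R p
      [-y]^p≈-y^p = mod-trans (≈⇒≈mod (trans (^-congˡ p (sym (-1*x≈-x y))) (^-distrib-* (- 1#) y p)))
                    (mod-trans (*-cong-mod -1^p≈-1 (≈⇒≈mod refl)) (≈⇒≈mod (-1*x≈-x (y ^ p))))

module UnitProperties (R : CommutativeRing 0ℓ 0ℓ) where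
  open CommutativeRing R
  open import Algebra.Definitions.RawSemiring (Semiring.rawSemiring semiring) using (_^_)
  open import Algebra.Properties.CommutativeSemigroup *-commutativeSemigroup using (interchange)
  open import Relation.Binary.Reasoning.Setoid setoid

  unit-resp : ∀ {x y} → x ≈ y → IsUnit R y → IsUnit R x
  unit-resp x≈y (v , yv≈1) = v , trans (*-congʳ x≈y) yv≈1

  *-unit : ∀ {x y} → IsUnit R x → IsUnit R y → IsUnit R (x * y)
  *-unit {x} {y} (v , xv≈1) (w , yw≈1) =
    v * w , trans (interchange x y v w) (trans (*-cong xv≈1 yw≈1) (*-identityʳ 1#))

  ^-unit : ∀ {x} → IsUnit R x → ∀ k → IsUnit R (x ^ k)
  ^-unit x-unit zero    = 1# , *-identityʳ 1#
  ^-unit x-unit (suc k) = *-unit x-unit (^-unit x-unit k)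

  *unit≈0⇒≈0 : ∀ {x u} → IsUnit R u → x * u ≈ 0# → x ≈ 0#
  *unit≈0⇒≈0 {x} {u} (v , uv≈1) xu≈0 = begin
    x             ≈⟨ *-identityʳ x ⟨
    x * 1#        ≈⟨ *-congˡ uv≈1 ⟨
    x * (u * v)   ≈⟨ *-assoc x u v ⟨
    (x * u) * v   ≈⟨ *-congʳ xu≈0 ⟩
    0# * v        ≈⟨ zeroˡ v ⟩
    0#            ∎

  unit⇒≉0 : ¬ 1# ≈ 0# → ∀ {u} → IsUnit R u → ¬ u ≈ 0#
  unit⇒≉0 1≉0 {u} (v , uv≈1) u≈0 = 1≉0 (trans (sym uv≈1) (trans (*-congʳ u≈0) (zeroˡ v)))

module FiniteRingProperties (R : CommutativeRing 0ℓ 0ℓ) {n} (card : Card R n) where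
  open CommutativeRing R
  open Bijection card using (to; injective)

  pigeonhole : (f : ℕ → Carrier) → ∃₂ λ i d → i ℕ.+ suc d ≤ n × f i ≈ f (i ℕ.+ suc d)
  pigeonhole f with Fin.pigeonhole (ℕ.n<1+n n) (to ∘ f ∘ Fin.toℕ)
  ... | i , j , i<j , to[fi]≡to[fj] with ℕ.m≤n⇒∃[o]m+o≡n i<j
  ...   | d , 1+i+d≡j = Fin.toℕ i , d , ≡.subst (_≤ n) (≡.sym i+1+d≡j) (ℕ.≤-pred (Fin.toℕ<n j))
                      , ≡.subst (λ k → f (Fin.toℕ i) ≈ f k) (≡.sym i+1+d≡j) (injective to[fi]≡to[fj])
    where
    i+1+d≡j : Fin.toℕ i ℕ.+ suc d ≡ Fin.toℕ j
    i+1+d≡j = ≡.trans (ℕ.+-suc (Fin.toℕ i) d) 1+i+d≡j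

module MaximalIdealProperties (R : CommutativeRing 0ℓ 0ℓ) {M} (M-maximal : IsMaximalIdeal R M) where
  open CommutativeRing R
  open IdealProperties R
  open IsMaximalIdeal M-maximal renaming (ideal to M-ideal; proper to 1∉M)

  -- Maximality is a classical notion: applied to the ideal M ∪ {x | P} it decides P.
  excluded-middle : (P : Set) → Dec P
  excluded-middle P with maximal (λ x → M x ⊎ P) (∪-const-isIdeal M-ideal P) inj₁
  ... | inj₁ (M∪P⊆M , _) = no (λ p → 1∉M (M∪P⊆M (inj₂ p)))
  ... | inj₂ (inj₁ 1∈M)  = contradiction 1∈M 1∉M
  ... | inj₂ (inj₂ p)    = yes p

  Settles : Pred Carrier 0ℓ → Carrier → Set₁
  Settles J x = J x ⊎ (∀ {K} → IsIdeal R K → J ⊆ K → K x → K 1#)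

  Settles-mono : ∀ {J J′ x} → J ⊆ J′ → Settles J x → Settles J′ x
  Settles-mono J⊆J′ (inj₁ Jx)     = inj₁ (J⊆J′ Jx)
  Settles-mono J⊆J′ (inj₂ x-fills) = inj₂ (λ K-ideal J′⊆K → x-fills K-ideal (J′⊆K ∘ J⊆J′))

  Settles-resp : ∀ {J x y} → IsIdeal R J → x ≈ y → Settles J x → Settles J y
  Settles-resp J-ideal x≈y (inj₁ Jx)     = inj₁ (IsIdeal.resp J-ideal x≈y Jx)
  Settles-resp J-ideal x≈y (inj₂ x-fills) = inj₂ (λ K-ideal J⊆K Ky → x-fills K-ideal J⊆K (IsIdeal.resp K-ideal (sym x≈y) Ky))

  settle : ∀ {I} → IsProperIdeal I → ∀ x → Σ (Pred Carrier 0ℓ) λ J → IsProperIdeal J × I ⊆ J × Settles J x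
  settle {I} I-proper@(I-ideal , _) x with excluded-middle ((I +⟨ x ⟩) 1#)
  ... | yes 1∈I+x = I , I-proper , id , inj₂ (λ K-ideal I⊆K Kx → +⟨⟩-least K-ideal I⊆K Kx 1∈I+x)
  ... | no  1∉I+x = I +⟨ x ⟩ , (+⟨⟩-isIdeal x , 1∉I+x) , ⊆+⟨⟩ x , inj₁ (∈+⟨⟩ x)
    where open Ideal I-ideal

  settle-all : ∀ {I k} → IsProperIdeal I → (xs : Fin k → Carrier) →
               Σ (Pred Carrier 0ℓ) λ J → IsProperIdeal J × I ⊆ J × (∀ i → Settles J (xs i))
  settle-all {k = zero}  I-proper xs = _ , I-proper , id , λ ()
  settle-all {k = suc k} I-proper xs with settle I-proper (xs Fin.zero)
  ... | J , J-proper , I⊆J , J-settles-x₀ with settle-all J-proper (xs ∘ Fin.suc)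
  ...   | K , K-proper , J⊆K , K-settles = K , K-proper , J⊆K ∘ I⊆J , λ
    { Fin.zero    → Settles-mono J⊆K J-settles-x₀
    ; (Fin.suc i) → K-settles i
    }

  settles-all⇒maximal : ∀ {J} → IsProperIdeal J → (∀ x → Settles J x) → IsMaximalIdeal R J
  settles-all⇒maximal {J} (J-ideal , 1∉J) settles = record
    { ideal = J-ideal ; proper = 1∉J ; maximal = λ _ → maximality }
    where
    maximality : ∀ {K} → IsIdeal R K → J ⊆ K → _≐_ R K J ⊎ K 1#
    maximality {K} K-ideal J⊆K with excluded-middle (K 1#)
    ... | yes 1∈K = inj₂ 1∈K
    ... | no  1∉K = inj₁ (K⊆J , J⊆K)
      where
      K⊆J : K ⊆ J
      K⊆J {x} Kx = [ id , (λ x-fills → contradiction (x-fills K-ideal J⊆K Kx) 1∉K) ]′ (settles x)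

  ⊆maximal : ∀ {n I} → Card R n → IsProperIdeal I → Σ (Pred Carrier 0ℓ) λ J → IsMaximalIdeal R J × I ⊆ J
  ⊆maximal card I-proper
    with J , J-proper , I⊆J , settles ← settle-all I-proper (Inverse.from (Bijection⇒Inverse card)) =
    J , settles-all⇒maximal J-proper all-settled , I⊆J
    where
    open Inverse (Bijection⇒Inverse card) using (to; strictlyInverseʳ)
    all-settled : ∀ x → Settles J x
    all-settled x = Settles-resp (proj₁ J-proper) (strictlyInverseʳ x) (settles (to x))

module LocalRingProperties (R : CommutativeRing 0ℓ 0ℓ) {n} (card : Card R n) {M} (M-local : IsLocal R M) where
  open CommutativeRing R
  open import Algebra.Definitions.RawSemiring (Semiring.rawSemiring semiring) using (_^_)
  open import Algebra.Properties.Semiring.Exp semiring using (^-homo-*)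
  open import Algebra.Properties.CommutativeSemigroup *-commutativeSemigroup using (x∙yz≈y∙xz)
  open import Relation.Binary.Reasoning.Setoid setoid
  open IdealProperties R
  open UnitProperties R
  open FiniteRingProperties R card
  open IsLocal M-local renaming (maxM to M-maximal; unique to M-unique)
  open IsMaximalIdeal M-maximal renaming (ideal to M-ideal; proper to 1∉M)
  open MaximalIdealProperties R M-maximal using (excluded-middle; ⊆maximal)
  open Ideal M-ideal

  1≉0 : ¬ 1# ≈ 0#
  1≉0 1≈0 = 1∉M (resp (sym 1≈0) zero∈)

  proper⇒⊆M : ∀ {I} → IsProperIdeal I → I ⊆ M
  proper⇒⊆M I-proper Ix with ⊆maximal card I-proper
  ... | J , J-maximal , I⊆J = proj₁ (M-unique J J-maximal) (I⊆J Ix)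

  nonunit⇒∈M : ∀ {u} → ¬ IsUnit R u → M u
  nonunit⇒∈M {u} ¬unit = proper⇒⊆M (Multiples-isIdeal u , 1∉uR) (1# , sym (*-identityʳ u))
    where
    1∉uR : ¬ Multiples u 1#
    1∉uR (v , 1≈uv) = ¬unit (v , sym 1≈uv)

  unit⊎∈M : ∀ u → IsUnit R u ⊎ M u
  unit⊎∈M u with excluded-middle (IsUnit R u)
  ... | yes unit = inj₁ unit
  ... | no ¬unit = inj₂ (nonunit⇒∈M ¬unit)

  unit⇒∉M : ∀ {u} → IsUnit R u → ¬ M u
  unit⇒∉M (v , uv≈1) Mu = 1∉M (resp uv≈1 (*-clʳ v Mu))

  1+∈M⇒unit : ∀ {m} → M m → IsUnit R (1# + m)
  1+∈M⇒unit {m} Mm with unit⊎∈M (1# + m)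
  ... | inj₁ unit  = unit
  ... | inj₂ M1+m = contradiction (resp (cancel 1# m) (+-cl M1+m (-‿cl Mm))) 1∉M
    where
    open IntegerCoefficientSolver R using (solve; _:=_; _:+_; _:-_)
    cancel : ∀ x y → (x + y) - y ≈ x
    cancel = solve 2 (λ x y → (x :+ y) :- y := x) refl

  ∈M-prime : ∀ {x y} → M (x * y) → M x ⊎ M y
  ∈M-prime {x} {y} Mxy with unit⊎∈M x
  ... | inj₂ Mx            = inj₁ Mx
  ... | inj₁ (v , xv≈1) = inj₂ (resp v[xy]≈y (*-cl v Mxy))
    where
    v[xy]≈y : v * (x * y) ≈ y
    v[xy]≈y = begin
      v * (x * y)  ≈⟨ x∙yz≈y∙xz v x y ⟩
      x * (v * y)  ≈⟨ *-assoc x v y ⟨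
      (x * v) * y  ≈⟨ *-congʳ xv≈1 ⟩
      1# * y       ≈⟨ *-identityˡ y ⟩
      y            ∎

  ^∈M⇒∈M : ∀ {x} k .{{_ : NonZero k}} → M (x ^ k) → M x
  ^∈M⇒∈M (suc zero)    Mx^1   = [ id , (λ M1 → contradiction M1 1∉M) ]′ (∈M-prime Mx^1)
  ^∈M⇒∈M (suc (suc k)) Mx^2+k = [ id , ^∈M⇒∈M (suc k) ]′ (∈M-prime Mx^2+k)

  -- y (1 - z) = 0 and 1 - z is a unit.
  ≈*∈M⇒≈0 : ∀ {y z} → M z → y ≈ y * z → y ≈ 0#
  ≈*∈M⇒≈0 {y} {z} Mz y≈yz = *unit≈0⇒≈0 (1+∈M⇒unit (-‿cl Mz)) (begin
    y * (1# - z)   ≈⟨ x[y-z]≈xy-xz y 1# z ⟩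
    y * 1# - y * z ≈⟨ +-cong (*-identityʳ y) (-‿cong (sym y≈yz)) ⟩
    y - y          ≈⟨ -‿inverseʳ y ⟩
    0#             ∎)
    where open import Algebra.Properties.Ring ring using (x[y-z]≈xy-xz)

  ∈M⇒nilpotent : ∀ {x} → M x → ∀ k → n ≤ k → x ^ k ≈ 0#
  ∈M⇒nilpotent {x} Mx k n≤k with pigeonhole (x ^_)
  ... | i , d , i+1+d≤n , x^i≈x^[i+1+d] = begin
    x ^ k                    ≡⟨ ≡.cong (x ^_) (ℕ.m+[n∸m]≡n i≤k) ⟨
    x ^ (i ℕ.+ (k ℕ.∸ i))    ≈⟨ ^-homo-* x i (k ℕ.∸ i) ⟩
    x ^ i * x ^ (k ℕ.∸ i)    ≈⟨ *-congʳ x^i≈0 ⟩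
    0# * x ^ (k ℕ.∸ i)       ≈⟨ zeroˡ _ ⟩
    0#                       ∎
    where
    i≤k : i ≤ k
    i≤k = ℕ.≤-trans (ℕ.m≤m+n i (suc d)) (ℕ.≤-trans i+1+d≤n n≤k)
    x^i≈0 : x ^ i ≈ 0#
    x^i≈0 = ≈*∈M⇒≈0 (*-clʳ (x ^ d) Mx) (trans x^i≈x^[i+1+d] (^-homo-* x i (suc d)))

  field⇔M⊆0 : IsField R ⇔ M ⊆ zeroIdeal R
  field⇔M⊆0 = mk⇔ field⇒M⊆0 M⊆0⇒field
    where
    field⇒M⊆0 : IsField R → M ⊆ zeroIdeal R
    field⇒M⊆0 (_ , inverse) {x} Mx with excluded-middle (x ≈ 0#)
    ... | yes x≈0 = x≈0
    ... | no  x≉0 = contradiction Mx (unit⇒∉M (inverse x x≉0))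
    M⊆0⇒field : M ⊆ zeroIdeal R → IsField R
    M⊆0⇒field M⊆0 = 1≉0 , λ x x≉0 → [ id , (λ Mx → contradiction (M⊆0 Mx) x≉0) ]′ (unit⊎∈M x)

module ResidueFieldFrobenius (R : CommutativeRing 0ℓ 0ℓ) {n} (card : Card R n) {M} (M-local : IsLocal R M)
  {p} (p-prime : Prime p) (pR⊆M : multiplesOf R p ⊆ M) where
  open CommutativeRing R
  open import Algebra.Definitions.RawSemiring (Semiring.rawSemiring semiring) using (_^_)
  open IdealProperties R
  open FrobeniusProperties R using (frobenius-‿)
  open FiniteRingProperties R card
  open LocalRingProperties R card M-local
  open Ideal (IsMaximalIdeal.ideal (IsLocal.maxM M-local))
  private instance _ = prime⇒nonZero p-prime

  frobenius-injective : ∀ {a b} → a ^ p ≈ b ^ p mod M → a ≈ b mod M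
  frobenius-injective {a} {b} a^p≈b^p = ^∈M⇒∈M p (∈-resp-mod (pR⊆M (frobenius-‿ p-prime a b)) a^p≈b^p)

  frobenius^ : ℕ → Carrier → Carrier
  frobenius^ zero    x = x
  frobenius^ (suc k) x = frobenius^ k x ^ p

  frobenius^-cancel : ∀ i e r → frobenius^ i r ≈ frobenius^ (i ℕ.+ e) r mod M → r ≈ frobenius^ e r mod M
  frobenius^-cancel zero    e r eq = eq
  frobenius^-cancel (suc i) e r eq = frobenius^-cancel i e r (frobenius-injective eq)

  -- Injective on the finite set R/M, hence surjective: some Frobenius iterate of r repeats.
  frobenius-surjective : ∀ r → ∃ λ a → r ≈ a ^ p mod M
  frobenius-surjective r with pigeonhole (λ k → frobenius^ k r)
  ... | i , d , _ , r[i]≈r[i+1+d] = frobenius^ d r , frobenius^-cancel i (suc d) r (≈⇒≈mod r[i]≈r[i+1+d])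

module CayleyGraphConnectivity (R : CommutativeRing 0ℓ 0ℓ) {n} (card : Card R n) {M} (M-local : IsLocal R M)
  {p} (p-prime : Prime p) (pR⊆M : multiplesOf R p ⊆ M) (-1∈Uᵖ : UnitPow R p (CommutativeRing.-_ R (CommutativeRing.1# R))) where
  open CommutativeRing R
  open import Algebra.Definitions.RawSemiring (Semiring.rawSemiring semiring) using (_^_) renaming (_×_ to _·_)
  open import Algebra.Properties.Semiring.Exp semiring using (^-assocʳ)
  open import Algebra.Properties.CommutativeSemiring.Exp commutativeSemiring using (^-distrib-*)
  open import Algebra.Properties.Monoid.Mult *-monoid using () renaming (×-idem to ^-idem)
  open import Algebra.Properties.Ring ring using (-1*x≈-x; -0#≈0#)
  open import Relation.Binary.Reasoning.Setoid setoid
  open IntegerCoefficientSolver R using (solve; _:=_; _:+_; _:-_; _:*_; :-_)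
  open IdealProperties R
  open UnitProperties R using (*-unit)
  open FrobeniusProperties R using (freshman's-dream; ·1*≈·)
  open LocalRingProperties R card M-local using (unit⊎∈M; unit⇒∉M; ^∈M⇒∈M; ∈M⇒nilpotent)
  open ResidueFieldFrobenius R card M-local p-prime pR⊆M using (frobenius-surjective)
  module M  = Ideal (IsMaximalIdeal.ideal (IsLocal.maxM M-local))
  module pR = Ideal (multiplesOf-isIdeal p)
  private instance _ = prime⇒nonZero p-prime

  q : Carrier
  q = p · 1#

  Walk : Carrier → Carrier → Set
  Walk = Star (λ x y → x ≈ y ⊎ Adj R p x y)

  Reachable : Pred Carrier 0ℓ
  Reachable x = ∀ a → Walk a (a + x)

  ≈⇒walk : ∀ {a b} → a ≈ b → Walk a b
  ≈⇒walk a≈b = inj₁ a≈b ◅ ε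

  reachable-resp : ∀ {x y} → x ≈ y → Reachable x → Reachable y
  reachable-resp x≈y x-reachable a = x-reachable a ◅◅ ≈⇒walk (+-congˡ x≈y)

  0-reachable : Reachable 0#
  0-reachable a = ≈⇒walk (sym (+-identityʳ a))

  +-reachable : ∀ {x y} → Reachable x → Reachable y → Reachable (x + y)
  +-reachable {x} {y} x-reachable y-reachable a =
    x-reachable a ◅◅ y-reachable (a + x) ◅◅ ≈⇒walk (+-assoc a x y)

  ·-reachable : ∀ k {y} → Reachable y → Reachable (k · y)
  ·-reachable zero    _           = 0-reachable
  ·-reachable (suc k) y-reachable = +-reachable y-reachable (·-reachable k y-reachable)

  q^*-reachable : ∀ k {y} → Reachable y → Reachable (q ^ k * y)
  q^*-reachable zero        y-reachable = reachable-resp (sym (*-identityˡ _)) y-reachable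
  q^*-reachable (suc k) {y} y-reachable =
    reachable-resp (trans (sym (·1*≈· p _)) (sym (*-assoc q (q ^ k) y))) (·-reachable p (q^*-reachable k y-reachable))

  -‿Uᵖ : ∀ {s} → UnitPow R p s → UnitPow R p (- s)
  -‿Uᵖ {s} (u , u-unit , s≈u^p) = w * u , *-unit w-unit u-unit , (begin
    - s            ≈⟨ -1*x≈-x s ⟨
    - 1# * s       ≈⟨ *-cong -1≈w^p s≈u^p ⟩
    w ^ p * u ^ p  ≈⟨ ^-distrib-* w u p ⟨
    (w * u) ^ p    ∎)
    where
    w = proj₁ -1∈Uᵖ
    w-unit = proj₁ (proj₂ -1∈Uᵖ)
    -1≈w^p = proj₂ (proj₂ -1∈Uᵖ)

  -- An edge from a to a + s needs a - (a + s) = -s in (R^×)^p, whence the use of -1 ∈ (R^×)^p.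
  Uᵖ⇒reachable : ∀ {s} → UnitPow R p s → Reachable s
  Uᵖ⇒reachable {s} s∈Uᵖ a with -‿Uᵖ s∈Uᵖ
  ... | u , u-unit , -s≈u^p = inj₂ (u , u-unit , trans (a-[a+s]≈-s a s) -s≈u^p) ◅ ε
    where
    a-[a+s]≈-s : ∀ a s → a - (a + s) ≈ - s
    a-[a+s]≈-s = solve 2 (λ a s → a :- (a :+ s) := :- s) refl

  module _ (M⊆pR : M ⊆ multiplesOf R p) where

    decompose : ∀ r → ∃₂ λ s r′ → Reachable s × r ≈ s + q * r′
    decompose r with unit⊎∈M r
    ... | inj₂ Mr with M⊆pR Mr
    ...   | r′ , r≈qr′ = 0# , r′ , 0-reachable , trans r≈qr′ (sym (+-identityˡ _))
    decompose r | inj₁ r-unit with frobenius-surjective r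
    ... | a , r≈a^p with M⊆pR r≈a^p
    ...   | r′ , r-a^p≈qr′ = a ^ p , r′ , Uᵖ⇒reachable (a , a-unit , refl) , trans (split r (a ^ p)) (+-congˡ r-a^p≈qr′)
      where
      split : ∀ r b → r ≈ b + (r - b)
      split = solve 2 (λ r b → r := b :+ (r :- b)) refl
      a-unit : IsUnit R a
      a-unit = [ id , (λ Ma → contradiction (M.∈-resp-mod r≈a^p (M.^-cl p Ma)) (unit⇒∉M r-unit)) ]′ (unit⊎∈M a)

    q-adic-decompose : ∀ k r → ∃₂ λ s r′ → Reachable s × r ≈ s + q ^ k * r′
    q-adic-decompose zero r = 0# , r , 0-reachable , sym (trans (+-identityˡ _) (*-identityˡ r))
    q-adic-decompose (suc k) r with q-adic-decompose k r
    ... | s , r′ , s-reachable , r≈s+qᵏr′ with decompose r′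
    ...   | s′ , r″ , s′-reachable , r′≈s′+qr″ =
      s + q ^ k * s′ , r″ , +-reachable s-reachable (q^*-reachable k s′-reachable) , (begin
        r                              ≈⟨ r≈s+qᵏr′ ⟩
        s + q ^ k * r′                 ≈⟨ +-congˡ (*-congˡ r′≈s′+qr″) ⟩
        s + q ^ k * (s′ + q * r″)      ≈⟨ regroup s (q ^ k) s′ q r″ ⟩
        s + q ^ k * s′ + q ^ suc k * r″ ∎)
      where
      regroup : ∀ s Q s′ q r″ → s + Q * (s′ + q * r″) ≈ s + Q * s′ + (q * Q) * r″
      regroup = solve 5 (λ s Q s′ q r″ → s :+ Q :* (s′ :+ q :* r″) := s :+ Q :* s′ :+ (q :* Q) :* r″) refl

    M⊆pR⇒connected : Connected R p
    M⊆pR⇒connected a b with q-adic-decompose n (b - a)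
    ... | s , r′ , s-reachable , b-a≈s+qⁿr′ = s-reachable a ◅◅ ≈⇒walk (begin
      a + s                 ≈⟨ +-congˡ (+-identityʳ s) ⟨
      a + (s + 0#)          ≈⟨ +-congˡ (+-congˡ (trans (*-congʳ qⁿ≈0) (zeroˡ r′))) ⟨
      a + (s + q ^ n * r′)  ≈⟨ +-congˡ b-a≈s+qⁿr′ ⟨
      a + (b - a)           ≈⟨ a+[b-a]≈b a b ⟩
      b                     ∎)
      where
      qⁿ≈0 : q ^ n ≈ 0#
      qⁿ≈0 = ∈M⇒nilpotent (pR⊆M (1# , sym (*-identityʳ q))) n ℕ.≤-refl
      a+[b-a]≈b : ∀ a b → a + (b - a) ≈ b
      a+[b-a]≈b = solve 2 (λ a b → a :+ (b :- a) := b) refl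

  PowerModpR : Pred Carrier 0ℓ
  PowerModpR x = ∃ λ a → x ≈ a ^ p mod multiplesOf R p

  powerModpR-resp : ∀ {x y} → x ≈ y → PowerModpR x → PowerModpR y
  powerModpR-resp x≈y (a , x≈a^p) = a , pR.mod-trans (pR.≈⇒≈mod (sym x≈y)) x≈a^p

  0-powerModpR : PowerModpR 0#
  0-powerModpR = 0# , pR.≈⇒≈mod (sym (^-idem (zeroˡ 0#) p))

  +-powerModpR : ∀ {x y} → PowerModpR x → PowerModpR y → PowerModpR (x + y)
  +-powerModpR (a , x≈a^p) (b , y≈b^p) =
    a + b , pR.mod-trans (pR.+-cong-mod x≈a^p y≈b^p) (pR.mod-sym (freshman's-dream p-prime a b))

  walk⇒powerModpR : ∀ {a b} → Walk a b → PowerModpR (a - b)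
  walk⇒powerModpR {a} ε = powerModpR-resp (sym (-‿inverseʳ a)) 0-powerModpR
  walk⇒powerModpR (inj₁ a≈c ◅ c⇝b) = powerModpR-resp (+-congʳ (sym a≈c)) (walk⇒powerModpR c⇝b)
  walk⇒powerModpR {a} {b} (_◅_ {j = c} (inj₂ (u , _ , a-c≈u^p)) c⇝b) =
    powerModpR-resp (telescope a c b) (+-powerModpR (u , pR.≈⇒≈mod a-c≈u^p) (walk⇒powerModpR c⇝b))
    where
    telescope : ∀ a c b → (a - c) + (c - b) ≈ a - b
    telescope = solve 3 (λ a c b → (a :- c) :+ (c :- b) := a :- b) refl

  module _ (connected : Connected R p) where

    frobenius-surjective-mod-pR : ∀ r → PowerModpR r
    frobenius-surjective-mod-pR r =
      powerModpR-resp (trans (+-congˡ -0#≈0#) (+-identityʳ r)) (walk⇒powerModpR (connected r 0#))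

    ∈M⇒≈^pᵏ : ∀ {m} → M m → ∀ k → ∃ λ y → M y × m ≈ y ^ (p ℕ.^ k) mod multiplesOf R p
    ∈M⇒≈^pᵏ {m} Mm zero = m , Mm , pR.≈⇒≈mod (sym (*-identityʳ m))
    ∈M⇒≈^pᵏ Mm (suc k) with ∈M⇒≈^pᵏ Mm k
    ... | y , My , m≈y^pᵏ with frobenius-surjective-mod-pR y
    ...   | z , y≈z^p = z , Mz , pR.mod-trans m≈y^pᵏ
                               (pR.mod-trans (pR.^-cong-mod (p ℕ.^ k) y≈z^p) (pR.≈⇒≈mod (^-assocʳ z p (p ℕ.^ k))))
      where
      Mz : M z
      Mz = ^∈M⇒∈M p (M.∈-resp-mod (pR⊆M (pR.mod-sym y≈z^p)) My)

    connected⇒M⊆pR : M ⊆ multiplesOf R p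
    connected⇒M⊆pR {m} Mm with ∈M⇒≈^pᵏ Mm n
    ... | y , My , m≈y^pⁿ = pR.∈-resp-mod m≈y^pⁿ (pR.resp (sym y^pⁿ≈0) pR.zero∈)
      where
      y^pⁿ≈0 : y ^ (p ℕ.^ n) ≈ 0#
      y^pⁿ≈0 = ∈M⇒nilpotent My (p ℕ.^ n) (ℕ.<⇒≤ (n<m^n (ℕ.nonTrivial⇒n>1 p {{prime⇒nonTrivial p-prime}}) n))

  connected⇔M≐pR : Connected R p ⇔ _≐_ R M (multiplesOf R p)
  connected⇔M≐pR = mk⇔
    (λ connected → (λ {x} → connected⇒M⊆pR connected {x}) , (λ {x} → pR⊆M {x}))
    (λ M≐pR → M⊆pR⇒connected (λ {x} → proj₁ M≐pR {x}))

module CharacteristicTwo (R : CommutativeRing 0ℓ 0ℓ) {n} (card : Card R n) {M} (M-local : IsLocal R M)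
  (2R⊆M : multiplesOf R 2 ⊆ M) (-1∈U² : UnitPow R 2 (CommutativeRing.-_ R (CommutativeRing.1# R))) where
  open CommutativeRing R
  open import Algebra.Definitions.RawSemiring (Semiring.rawSemiring semiring) using (_^_) renaming (_×_ to _·_)
  open import Algebra.Properties.Semiring.Exp semiring using (^-congˡ)
  open import Algebra.Properties.Ring ring using (-0#≈0#; x≈y⇒x∙y⁻¹≈ε; x∙y⁻¹≈ε⇒x≈y)
  open import Relation.Binary.Reasoning.Setoid setoid
  open IntegerCoefficientSolver R using (solve; _:=_; _:+_; _:-_; _:*_; :-_; con)
  open IdealProperties R
  open UnitProperties R
  open FrobeniusProperties R using (frobenius-‿)
  open LocalRingProperties R card M-local using (1≉0; 1+∈M⇒unit; ^∈M⇒∈M; field⇔M⊆0)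
  open ResidueFieldFrobenius R card M-local prime[2] 2R⊆M using (frobenius-surjective)
  open CayleyGraphConnectivity R card M-local prime[2] 2R⊆M -1∈U² using (connected⇔M≐pR)
  open Bijection card using (to; injective)
  module 2R = Ideal (multiplesOf-isIdeal 2)

  -- With -1 = u²: (u - 1)² ≡ u² - 1 = -2 mod 2R puts u - 1 into M = 2R, say u = 1 + 2c,
  -- and then 0 = 1 + u² = 2 (1 + 2(c + c²)) where the second factor is a unit.
  M⊆2R⇒2≈0 : M ⊆ multiplesOf R 2 → 2 · 1# ≈ 0#
  M⊆2R⇒2≈0 M⊆2R = *unit≈0⇒≈0 (1+∈M⇒unit (2R⊆M (c + c * c , refl))) (begin
    2 · 1# * (1# + m)                ≈⟨ expand c ⟨
    1# + (1# + 2 · 1# * c) ^ 2       ≈⟨ +-congˡ (^-congˡ 2 u≈1+2c) ⟨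
    1# + u ^ 2                       ≈⟨ +-congˡ -1≈u² ⟨
    1# - 1#                          ≈⟨ -‿inverseʳ 1# ⟩
    0#                               ∎)
    where
    u = proj₁ -1∈U²
    -1≈u² = proj₂ (proj₂ -1∈U²)
    one two : ∀ {k} → IntegerCoefficientSolver.Polynomial R k
    one = con (ℤ.+ 1)
    -- evaluates to 1# + (1# + 0#), which is 2 · 1# by definition
    two = one :+ (one :+ con (ℤ.+ 0))
    u²-1²∈2R : multiplesOf R 2 (u ^ 2 - 1# ^ 2)
    u²-1²∈2R = - 1# , (begin
      u ^ 2 - 1# ^ 2     ≈⟨ +-congʳ -1≈u² ⟨
      - 1# - 1# ^ 2      ≈⟨ solve 0 (:- one :- one :* (one :* one) := two :* :- one) refl ⟩
      2 · 1# * - 1#      ∎)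
    u-1∈2R : multiplesOf R 2 (u - 1#)
    u-1∈2R = M⊆2R (^∈M⇒∈M 2 (2R⊆M (2R.∈-resp-mod (frobenius-‿ prime[2] u 1#) u²-1²∈2R)))
    c = proj₁ u-1∈2R
    u≈1+2c : u ≈ 1# + 2 · 1# * c
    u≈1+2c = trans (solve 2 (λ u o → u := o :+ (u :- o)) refl u 1#) (+-congˡ (proj₂ u-1∈2R))
    m = 2 · 1# * (c + c * c)
    expand : ∀ c → 1# + (1# + 2 · 1# * c) ^ 2 ≈ 2 · 1# * (1# + 2 · 1# * (c + c * c))
    expand = solve 1 (λ c → one :+ (one :+ two :* c) :* ((one :+ two :* c) :* one)
                          := two :* (one :+ two :* (c :+ c :* c))) refl

  connected⇔M≐2R≐0 : Connected R 2 ⇔ (_≐_ R M (multiplesOf R 2) × _≐_ R (multiplesOf R 2) (zeroIdeal R))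
  connected⇔M≐2R≐0 = mk⇔
    (λ connected → let M≐2R = Equivalence.to connected⇔M≐pR connected in
                   M≐2R , Multiples-≈0 (M⊆2R⇒2≈0 (λ {x} → proj₁ M≐2R {x})))
    (λ (M≐2R , _) → Equivalence.from connected⇔M≐pR M≐2R)

  M≐2R≐0⇔field : (_≐_ R M (multiplesOf R 2) × _≐_ R (multiplesOf R 2) (zeroIdeal R)) ⇔ IsField R
  M≐2R≐0⇔field = mk⇔
    (λ ((M⊆2R , _) , (2R⊆0 , _)) → Equivalence.from field⇔M⊆0 (λ {x} Mx → 2R⊆0 (M⊆2R Mx)))
    field⇒M≐2R≐0
    where
    field⇒M≐2R≐0 : IsField R → _≐_ R M (multiplesOf R 2) × _≐_ R (multiplesOf R 2) (zeroIdeal R)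
    field⇒M≐2R≐0 R-field = ((λ {x} Mx → proj₂ 2R≐0 (M⊆0 Mx)) , (λ {x} → 2R⊆M {x})) , 2R≐0
      where
      M⊆0 = Equivalence.to field⇔M⊆0 R-field
      2R≐0 = Multiples-≈0 (M⊆0 (2R⊆M (1# , sym (*-identityʳ _))))

  field⇔isoComplete : IsField R ⇔ IsoComplete R 2 n
  field⇔isoComplete = mk⇔ field⇒isoComplete isoComplete⇒field
    where
    field⇒isoComplete : IsField R → IsoComplete R 2 n
    field⇒isoComplete R-field = card , λ a b → mk⇔ (adj⇒≢ a b) (≢⇒adj a b)
      where
      M⊆0 = Equivalence.to field⇔M⊆0 R-field
      adj⇒≢ : ∀ a b → Adj R 2 a b → ¬ to a ≡ to b
      adj⇒≢ a b (u , u-unit , a-b≈u²) to[a]≡to[b] =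
        unit⇒≉0 1≉0 (^-unit u-unit 2) (trans (sym a-b≈u²) (x≈y⇒x∙y⁻¹≈ε (injective to[a]≡to[b])))
      ≢⇒adj : ∀ a b → ¬ to a ≡ to b → Adj R 2 a b
      ≢⇒adj a b to[a]≢to[b] = c , proj₂ R-field c c≉0 , a-b≈c²
        where
        c = proj₁ (frobenius-surjective (a - b))
        a-b≈c² : a - b ≈ c ^ 2
        a-b≈c² = x∙y⁻¹≈ε⇒x≈y _ _ (M⊆0 (proj₂ (frobenius-surjective (a - b))))
        c≉0 : ¬ c ≈ 0#
        c≉0 c≈0 = to[a]≢to[b] (Bijection.cong card (x∙y⁻¹≈ε⇒x≈y a b
          (trans a-b≈c² (trans (^-congˡ 2 c≈0) (zeroˡ _)))))
    isoComplete⇒field : IsoComplete R 2 n → IsField R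
    isoComplete⇒field (f , adj⇔≢) = 1≉0 , inverse
      where
      inverse : ∀ x → ¬ x ≈ 0# → IsUnit R x
      inverse x x≉0 with Equivalence.from (adj⇔≢ x 0#) (λ eq → x≉0 (Bijection.injective f eq))
      ... | u , u-unit , x-0≈u² = unit-resp (trans (sym (trans (+-congˡ -0#≈0#) (+-identityʳ x))) x-0≈u²) (^-unit u-unit 2)

proposition4p6 : (p : ℕ) → Prime p → (R : CommutativeRing 0ℓ 0ℓ) →
    (n : ℕ) → Card R n →
    (M : Pred (CommutativeRing.Carrier R) 0ℓ) → IsLocal R M →
    ResidueChar R M p →
    UnitPow R p (CommutativeRing.-_ R (CommutativeRing.1# R)) →
    (Connected R p ⇔ _≐_ R M (multiplesOf R p))
    × (p ≡ 2 →
        (Connected R 2 ⇔ (_≐_ R M (multiplesOf R 2) × _≐_ R (multiplesOf R 2) (zeroIdeal R)))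
        × ((_≐_ R M (multiplesOf R 2) × _≐_ R (multiplesOf R 2) (zeroIdeal R)) ⇔ IsField R)
        × (IsField R ⇔ IsoComplete R 2 n))
proposition4p6 p p-prime R n card M M-local (_ , p·1∈M , _) -1∈Uᵖ =
  connected⇔M≐pR , λ { ≡.refl → let open CharacteristicTwo R card M-local pR⊆M -1∈Uᵖ in
                                  connected⇔M≐2R≐0 , M≐2R≐0⇔field , field⇔isoComplete }
  where
  pR⊆M : multiplesOf R p ⊆ M
  pR⊆M = IdealProperties.Multiples-least R (IsMaximalIdeal.ideal (IsLocal.maxM M-local)) p·1∈M
  open CayleyGraphConnectivity R card M-local p-prime pR⊆M -1∈Uᵖ using (connected⇔M≐pR)
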